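{- Let $m\ge1$, let $\epsilon=(\epsilon_1,\dots,\epsilon_s)$ be a circular sequence with $\epsilon_i\in\{1,-1\}$ for all $i$, and let $x_{l_1,t_1},x_{l_2,t_2},\dots,x_{l_n,t_n}$ be a free linear digraph of $\Gamma^m_\epsilon$ listed from origin to terminal (so $t_{i+1}\equiv t_i+1$ mod $s$). Then for each $i\in\{1,\dots,n\}$, \[l_i=\begin{cases}l_1+\sum_{j=1}^i\epsilon_{t_j}+1=m+\sum_{j=1}^i\epsilon_{t_j}&\text{if }\epsilon_{t_i}=-1,\\ l_1+\sum_{j=1}^i\epsilon_{t_j}=m-1+\sum_{j=1}^i\epsilon_{t_j}&\text{if }\epsilon_{t_i}=1.\end{cases}\] Moreover $\sum_{j=1}^n\epsilon_{t_j}=0$, and $-m\le\sum_{j=1}^i\epsilon_{t_j}<0$ for every $i\in\{1,\dots,n-1\}$.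
   Context: Indices are mod $s$. Digraph $\Gamma^m_\epsilon$: vertices $x_{i,t}$, $0\le i\le m-1$, $t\in\{1,\dots,s\}$, some "marked zero". If $s=1$: all vertices are marked zero, no edges. If $s\ge2$: for each $t$ let $A_t=\max(\epsilon_t,0)$, $B_t=\max(-\epsilon_{t+1},0)$; for each $j\in\{0,\dots,m-1\}$: if $j\ge\max(A_t,B_t)$ add an edge from $x_{j-A_t,t}$ to $x_{j-B_t,t+1}$ of weight $A_t-B_t$; if $A_t\le j<B_t$ mark $x_{j-A_t,t}$ zero; if $B_t\le j<A_t$ mark $x_{j-B_t,t+1}$ zero. Each connected component is a directed path (linear digraph) or a directed cycle; a linear digraph with no vertex marked zero is a free linear digraph. -}

module Defs where

open import Data.Nat as ℕ using (ℕ; zero; suc; _<_; _≤_; _<?_; s≤s)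
open import Data.Fin using (Fin; toℕ; fromℕ<) renaming (zero to fzero; suc to fsuc)
open import Data.Integer as ℤ using (ℤ; +_; _⊔_; -_; _-_)
open import Data.Product using (Σ; ∃; _×_; _,_)
open import Data.Sum using (_⊎_)
open import Relation.Nullary using (yes; no; ¬_)
open import Relation.Binary.PropositionalEquality using (_≡_)
open import Function.Definitions using (Injective)

-- successor modulo s on column indices (columns t ∈ {1..s} are Fin s, 0-based)
next : ∀ {s} → Fin s → Fin s
next {suc k} i with toℕ i <? k
... | yes p = fromℕ< (s≤s p)
... | no _  = fzero

IsSignSeq : ∀ {s} → (Fin s → ℤ) → Set
IsSignSeq ε = ∀ t → (ε t ≡ + 1) ⊎ (ε t ≡ ℤ.-[1+ 0 ])

module Γ (m s : ℕ) (ε : Fin s → ℤ) where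

  -- vertex x_{l,t} is the pair (l , t); valid when l < m
  Vertex : Set
  Vertex = ℕ × Fin s

  Valid : Vertex → Set
  Valid (l , _) = l < m

  A : Fin s → ℤ
  A t = ε t ⊔ + 0

  B : Fin s → ℤ
  B t = (- ε (next t)) ⊔ + 0

  Edge : Vertex → Vertex → Set
  Edge (l , t) (l' , t') =
    2 ≤ s × next t ≡ t' ×
    ∃ λ j → j < m × A t ℤ.≤ + j × B t ℤ.≤ + j ×
            + l ≡ + j - A t × + l' ≡ + j - B t

  MarkedZero : Vertex → Set
  MarkedZero (l , t) =
    s ≡ 1 ⊎
    (2 ≤ s ×
      ((∃ λ j → j < m × A t ℤ.≤ + j × + j ℤ.< B t × + l ≡ + j - A t)
      ⊎ (∃ λ t₀ → next t₀ ≡ t ×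
          ∃ λ j → j < m × B t₀ ℤ.≤ + j × + j ℤ.< A t₀ × + l ≡ + j - B t₀)))

  -- v 0, v 1, …, v n is a connected component of Γ which is the directed path
  -- v 0 → v 1 → … → v n (listed from origin to terminal) with no vertex marked zero
  IsFreeLinear : (n : ℕ) → (Fin (suc n) → Vertex) → Set
  IsFreeLinear n v =
    (∀ i → Valid (v i)) ×
    Injective _≡_ _≡_ v ×
    (∀ i i' → toℕ i' ≡ suc (toℕ i) → Edge (v i) (v i')) ×
    (∀ u w → Edge u w → (∃ λ i → v i ≡ u) ⊎ (∃ λ i → v i ≡ w) →
       ∃ λ i → ∃ λ i' → toℕ i' ≡ suc (toℕ i) × v i ≡ u × v i' ≡ w) ×
    (∀ i → ¬ MarkedZero (v i))

-- psum f k = f 0 + … + f (k-1)  (truncated at the length of f)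
psum : ∀ {n} → (Fin n → ℤ) → ℕ → ℤ
psum {zero} f _ = + 0
psum {suc n} f zero = + 0
psum {suc n} f (suc k) = f fzero ℤ.+ psum (λ i → f (fsuc i)) k

module Submission where

-- Give every vertex x_{l,t} the HEIGHT  h(l,t) = l + A_t,  where
-- A_t = max(ε_t,0) is the positive part of ε_t.  An edge x_{l,t} → x_{l',t+1}
-- is an index j < m with l + A_t = j = l' + B_t, and since
-- A_{t+1} - B_t = max(ε_{t+1},0) - max(-ε_{t+1},0) = ε_{t+1}, heights grow by
-- exactly ε along edges; moreover the tail of an edge has height j < m.
-- A vertex that is not marked zero and has no outgoing edge has height ≥ m,
-- and one with no incoming edge has l + B_{t-1} ≥ m.  For a ±1 sequence the
-- clamps are ≤ 1, so the origin of a free linear digraph sits in row m-1 with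
-- ε = -1, and its terminal sits in row m-1 with ε = +1.
-- By induction along the path, h(x_i) = m + (ε_{t_1} + … + ε_{t_i}); reading
-- the row off the height gives the coordinate formulas, the terminal gives
-- total sum 0, and 0 ≤ h < m at the tails of edges bounds the partial sums.

open import Defs
open import Data.Nat as ℕ using (ℕ; suc; _≤_)
open import Data.Fin using (Fin; toℕ) renaming (zero to fzero)
open import Data.Integer as ℤ using (ℤ; +_; _+_; _-_; -_)
open import Data.Product using (_×_; proj₁; proj₂)
open import Relation.Binary.PropositionalEquality using (_≡_)

open import Data.Nat using (zero; z≤n; s≤s; _<_; _<?_; _≤?_)
import Data.Nat.Properties as ℕP
open import Data.Fin using (fromℕ<; fromℕ; inject₁) renaming (suc to fsuc)
open import Data.Fin.Properties using (toℕ-fromℕ<; toℕ-inject₁; toℕ-fromℕ; toℕ<n; toℕ-injective)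
open import Data.Fin.Induction using (<-weakInduction)
import Data.Integer.Properties as ℤP
open import Data.Integer.Tactic.RingSolver using (solve-∀)
open import Data.Product using (∃; _,_)
open import Data.Sum using (_⊎_; inj₁; inj₂)
open import Data.Empty using (⊥-elim)
open import Relation.Nullary using (¬_; yes; no)
open import Relation.Binary.PropositionalEquality using (refl; sym; trans; cong; cong₂; subst; module ≡-Reasoning)

posPart : ℤ → ℕ
posPart (+ n)      = n
posPart ℤ.-[1+ _ ] = 0

⊔0≡posPart : ∀ x → x ℤ.⊔ + 0 ≡ + posPart x
⊔0≡posPart (+ n)      = cong +_ (ℕP.⊔-identityʳ n)
⊔0≡posPart ℤ.-[1+ _ ] = refl

-- x = max(x,0) - max(-x,0): the reason heights change by ε along edges.
posPart-split : ∀ x → + posPart x - + posPart (- x) ≡ x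
posPart-split (+ zero)    = refl
posPart-split (+ suc n)   = ℤP.+-identityʳ (+ suc n)
posPart-split ℤ.-[1+ _ ]  = refl

posPart-sign≤1 : ∀ {x} → (x ≡ + 1) ⊎ (x ≡ - + 1) → posPart x ≤ 1 × posPart (- x) ≤ 1
posPart-sign≤1 (inj₁ refl) = s≤s z≤n , z≤n
posPart-sign≤1 (inj₂ refl) = z≤n , s≤s z≤n

sign-from-posPart : ∀ {x} → (x ≡ + 1) ⊎ (x ≡ - + 1) → posPart x ≡ 1 → x ≡ + 1
sign-from-posPart (inj₁ x≡1) _  = x≡1
sign-from-posPart (inj₂ refl) ()

sign-from-negPart : ∀ {x} → (x ≡ + 1) ⊎ (x ≡ - + 1) → posPart (- x) ≡ 1 → x ≡ - + 1
sign-from-negPart (inj₁ refl) ()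
sign-from-negPart (inj₂ x≡-1) _ = x≡-1

top-row : ∀ {l c m} → l < m → m ≤ l ℕ.+ c → c ≤ 1 → c ≡ 1 × suc l ≡ m
top-row {l} {zero} {m} l<m m≤l+0 _ =
  ⊥-elim (ℕP.<⇒≱ l<m (subst (m ≤_) (ℕP.+-identityʳ l) m≤l+0))
top-row {l} {suc zero} {m} l<m m≤l+1 _ =
  refl , ℕP.≤-antisym l<m (subst (m ≤_) (ℕP.+-comm l 1) m≤l+1)
top-row {c = suc (suc _)} _ _ (s≤s ())

offset : ∀ {l c j} → l ℕ.+ c ≡ j → + l ≡ + j - + c
offset {l} {c} refl = begin
  + l                 ≡⟨ add-sub (+ l) (+ c) ⟩
  + l + + c - + c     ≡⟨ cong (_- + c) (ℤP.pos-+ l c) ⟨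
  + (l ℕ.+ c) - + c   ∎
  where
  open ≡-Reasoning
  add-sub : ∀ x y → x ≡ x + y - y
  add-sub = solve-∀

offset⁻¹ : ∀ {l c j} → + l ≡ + j - + c → l ℕ.+ c ≡ j
offset⁻¹ {l} {c} {j} l≡j-c = ℤP.+-injective (begin
  + (l ℕ.+ c)         ≡⟨ ℤP.pos-+ l c ⟩
  + l + + c           ≡⟨ cong (_+ + c) l≡j-c ⟩
  + j - + c + + c     ≡⟨ sub-add (+ j) (+ c) ⟩
  + j                 ∎)
  where
  open ≡-Reasoning
  sub-add : ∀ x y → x - y + y ≡ x
  sub-add = solve-∀

solve-for : ∀ {H} M {X : ℤ} → H ≡ M + X → X ≡ H - M
solve-for M {X} refl = add-sub-left M X
  where
  add-sub-left : ∀ x y → y ≡ x + y - x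
  add-sub-left = solve-∀

row-from-height : ∀ {l x} {H : ℤ} → + (l ℕ.+ posPart x) ≡ H →
  (x ≡ - + 1 → + l ≡ H) × (x ≡ + 1 → + l ≡ H - + 1)
row-from-height {l} refl =
  (λ { refl → cong +_ (sym (ℕP.+-identityʳ l)) }) , (λ { refl → offset {l} {1} refl })

shifted-bound : ∀ {h m} → h < m → (- + m ℤ.≤ + h - + m) × (+ h - + m ℤ.< + 0)
shifted-bound {h} {m} h<m rewrite ℤP.[+m]-[+n]≡m⊖n h m | ℤP.⊖-< h<m =
  ℤP.neg-mono-≤ (ℤ.+≤+ (ℕP.m∸n≤m m h)) , ℤP.neg-mono-< (ℤ.+<+ (ℕP.m<n⇒0<n∸m h<m))

two≤size : ∀ {s} → Fin s → ¬ (s ≡ 1) → 2 ≤ s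
two≤size {suc zero}    _ s≢1 = ⊥-elim (s≢1 refl)
two≤size {suc (suc _)} _ _   = s≤s (s≤s z≤n)

toℕ-next-< : ∀ {k} (i : Fin (suc k)) → toℕ i < k → toℕ (next i) ≡ suc (toℕ i)
toℕ-next-< {k} i i<k with toℕ i <? k
... | yes i<k' = toℕ-fromℕ< (s≤s i<k')
... | no  i≮k  = ⊥-elim (i≮k i<k)

toℕ-next-last : ∀ k → toℕ (next (fromℕ k)) ≡ 0
toℕ-next-last k with toℕ (fromℕ k) <? k
... | yes k<k = ⊥-elim (ℕP.n≮n k (subst (_< k) (toℕ-fromℕ k) k<k))
... | no  _   = refl

prev : ∀ {s} (t : Fin s) → ∃ λ p → next p ≡ t
prev {suc k} fzero    = fromℕ k , toℕ-injective (toℕ-next-last k)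
prev {suc k} (fsuc t) = inject₁ t ,
  toℕ-injective (trans (toℕ-next-< (inject₁ t) t<k) (cong suc (toℕ-inject₁ t)))
  where
  t<k : toℕ (inject₁ t) < k
  t<k = subst (_< k) (sym (toℕ-inject₁ t)) (toℕ<n t)

psum-zero : ∀ {n} (f : Fin n → ℤ) → psum f 0 ≡ + 0
psum-zero {zero}  _ = refl
psum-zero {suc _} _ = refl

psum-suc : ∀ {n} (f : Fin n → ℤ) (i : Fin n) → psum f (suc (toℕ i)) ≡ psum f (toℕ i) + f i
psum-suc {suc n} f fzero    = begin
  f fzero + psum g 0   ≡⟨ cong (λ z → f fzero + z) (psum-zero g) ⟩
  f fzero + + 0        ≡⟨ ℤP.+-comm (f fzero) (+ 0) ⟩
  + 0 + f fzero        ∎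
  where
  open ≡-Reasoning
  g : Fin n → ℤ
  g i = f (fsuc i)
psum-suc {suc n} f (fsuc i) = begin
  f fzero + psum g (suc (toℕ i))    ≡⟨ cong (λ z → f fzero + z) (psum-suc g i) ⟩
  f fzero + (psum g (toℕ i) + g i)  ≡⟨ ℤP.+-assoc (f fzero) (psum g (toℕ i)) (g i) ⟨
  f fzero + psum g (toℕ i) + g i    ∎
  where
  open ≡-Reasoning
  g : Fin n → ℤ
  g i = f (fsuc i)

psum-extend : ∀ {n} (f : Fin (suc n) → ℤ) (i : Fin n) →
  psum f (suc (toℕ (fsuc i))) ≡ psum f (suc (toℕ (inject₁ i))) + f (fsuc i)
psum-extend f i = trans (psum-suc f (fsuc i)) (cong (λ k → psum f (suc k) + f (fsuc i)) (sym (toℕ-inject₁ i)))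

module Geometry (m s : ℕ) (ε : Fin s → ℤ) where
  open Γ m s ε

  a⁺ b⁺ : Fin s → ℕ
  a⁺ t = posPart (ε t)
  b⁺ t = posPart (- ε (next t))

  height : Vertex → ℕ
  height (l , t) = l ℕ.+ a⁺ t

  private
    A≡a⁺ : ∀ t → A t ≡ + a⁺ t
    A≡a⁺ t = ⊔0≡posPart (ε t)

    B≡b⁺ : ∀ t → B t ≡ + b⁺ t
    B≡b⁺ t = ⊔0≡posPart (- ε (next t))

    clamp-≤ : ∀ {X c l j} → X ≡ + c → l ℕ.+ c ≡ j → X ℤ.≤ + j
    clamp-≤ {l = l} refl refl = ℤ.+≤+ (ℕP.m≤n+m _ l)

    clamp-> : ∀ {X c j} → X ≡ + c → j < c → + j ℤ.< X
    clamp-> refl j<c = ℤ.+<+ j<c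

    clamp-eq : ∀ {X c l j} → X ≡ + c → l ℕ.+ c ≡ j → + l ≡ + j - X
    clamp-eq refl l+c≡j = offset l+c≡j

  edge-index : ∀ {l t l' t'} → Edge (l , t) (l' , t') →
    next t ≡ t' × ∃ λ j → j < m × l ℕ.+ a⁺ t ≡ j × l' ℕ.+ b⁺ t ≡ j
  edge-index {t = t} (_ , t+1≡t' , j , j<m , _ , _ , l≡j-A , l'≡j-B) =
    t+1≡t' , j , j<m ,
    offset⁻¹ (trans l≡j-A (cong (λ X → + j - X) (A≡a⁺ t))) ,
    offset⁻¹ (trans l'≡j-B (cong (λ X → + j - X) (B≡b⁺ t)))

  edge : ∀ {l t l' j} → 2 ≤ s → j < m → l ℕ.+ a⁺ t ≡ j → l' ℕ.+ b⁺ t ≡ j →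
    Edge (l , t) (l' , next t)
  edge {t = t} two≤s j<m l+a≡j l'+b≡j =
    two≤s , refl , _ , j<m , clamp-≤ (A≡a⁺ t) l+a≡j , clamp-≤ (B≡b⁺ t) l'+b≡j ,
    clamp-eq (A≡a⁺ t) l+a≡j , clamp-eq (B≡b⁺ t) l'+b≡j

  marked-out : ∀ {l t} → 2 ≤ s → l ℕ.+ a⁺ t < m → l ℕ.+ a⁺ t < b⁺ t → MarkedZero (l , t)
  marked-out {t = t} two≤s j<m j<b =
    inj₂ (two≤s , inj₁ (_ , j<m , clamp-≤ (A≡a⁺ t) refl , clamp-> (B≡b⁺ t) j<b ,
                         clamp-eq (A≡a⁺ t) refl))

  marked-in : ∀ {l p t} → 2 ≤ s → next p ≡ t → l ℕ.+ b⁺ p < m → l ℕ.+ b⁺ p < a⁺ p →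
    MarkedZero (l , t)
  marked-in {p = p} two≤s p+1≡t j<m j<a =
    inj₂ (two≤s , inj₂ (p , p+1≡t , _ , j<m , clamp-≤ (B≡b⁺ p) refl ,
                         clamp-> (A≡a⁺ p) j<a , clamp-eq (B≡b⁺ p) refl))

  -- Heights change by ε along edges, since A_{t+1} - B_t = ε_{t+1}.
  edge-height : ∀ {l t l' t'} → Edge (l , t) (l' , t') →
    + height (l' , t') ≡ + height (l , t) + ε t'
  edge-height {l} {t} {l'} E with edge-index E
  ... | refl , j , _ , l+a≡j , l'+b≡j = begin
    + (l' ℕ.+ a⁺ (next t))           ≡⟨ ℤP.pos-+ l' _ ⟩
    + l' + + a⁺ (next t)             ≡⟨ cong (_+ + a⁺ (next t)) (offset l'+b≡j) ⟩
    + j - + b⁺ t + + a⁺ (next t)     ≡⟨ regroup (+ j) (+ b⁺ t) (+ a⁺ (next t)) ⟩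
    + j + (+ a⁺ (next t) - + b⁺ t)   ≡⟨ cong₂ _+_ (cong +_ (sym l+a≡j)) (posPart-split (ε (next t))) ⟩
    + (l ℕ.+ a⁺ t) + ε (next t)      ∎
    where
    open ≡-Reasoning
    regroup : ∀ x y z → x - y + z ≡ x + (z - y)
    regroup = solve-∀

  edge-tail-height : ∀ {l t w} → Edge (l , t) w → height (l , t) < m
  edge-tail-height E with edge-index E
  ... | _ , _ , j<m , l+a≡j , _ = subst (_< m) (sym l+a≡j) j<m

  -- An unmarked vertex without outgoing edges has height ≥ m: otherwise its height
  -- j < m would give an edge (B_t ≤ j) or a zero mark (j < B_t).
  sink-height : ∀ {l t} → 2 ≤ s → ¬ MarkedZero (l , t) → (∀ w → ¬ Edge (l , t) w) →
    m ≤ height (l , t)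
  sink-height {l} {t} two≤s unmarked no-out with height (l , t) <? m
  ... | no  h≮m = ℕP.≮⇒≥ h≮m
  ... | yes h<m with b⁺ t ≤? height (l , t)
  ...   | yes b≤h = ⊥-elim (no-out _ (edge two≤s h<m refl (ℕP.m∸n+n≡m b≤h)))
  ...   | no  b≰h = ⊥-elim (unmarked (marked-out two≤s h<m (ℕP.≰⇒> b≰h)))

  source-height : ∀ {l p t} → 2 ≤ s → next p ≡ t → ¬ MarkedZero (l , t) →
    (∀ u → ¬ Edge u (l , t)) → m ≤ l ℕ.+ posPart (- ε t)
  source-height {l} {p} two≤s refl unmarked no-in with l ℕ.+ b⁺ p <? m
  ... | no  j≮m = ℕP.≮⇒≥ j≮m
  ... | yes j<m with a⁺ p ≤? l ℕ.+ b⁺ p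
  ...   | yes a≤j = ⊥-elim (no-in _ (edge two≤s j<m (ℕP.m∸n+n≡m a≤j) refl))
  ...   | no  a≰j = ⊥-elim (unmarked (marked-in two≤s refl j<m (ℕP.≰⇒> a≰j)))

module FreePath (m s : ℕ) (ε : Fin s → ℤ) (sign : IsSignSeq ε)
                (n : ℕ) (v : Fin (suc n) → ℕ × Fin s) (free : Γ.IsFreeLinear m s ε n v) where
  open Γ m s ε
  open Geometry m s ε

  valid : ∀ i → Valid (v i)
  valid = proj₁ free

  injective : ∀ {i i'} → v i ≡ v i' → i ≡ i'
  injective = proj₁ (proj₂ free)

  consecutive : ∀ i i' → toℕ i' ≡ suc (toℕ i) → Edge (v i) (v i')
  consecutive = proj₁ (proj₂ (proj₂ free))

  closed : ∀ u w → Edge u w → (∃ λ i → v i ≡ u) ⊎ (∃ λ i → v i ≡ w) →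
    ∃ λ i → ∃ λ i' → toℕ i' ≡ suc (toℕ i) × v i ≡ u × v i' ≡ w
  closed = proj₁ (proj₂ (proj₂ (proj₂ free)))

  unmarked : ∀ i → ¬ MarkedZero (v i)
  unmarked = proj₂ (proj₂ (proj₂ (proj₂ free)))

  e : Fin (suc n) → ℤ
  e i = ε (proj₂ (v i))

  l : Fin (suc n) → ℤ
  l i = + proj₁ (v i)

  S : ℕ → ℤ
  S k = psum e k

  -- The origin is not marked zero, so s ≠ 1.
  two≤s : 2 ≤ s
  two≤s = two≤size (proj₂ (v fzero)) (λ s≡1 → unmarked fzero (inj₁ s≡1))

  path-edge : ∀ (i : Fin n) → Edge (v (inject₁ i)) (v (fsuc i))
  path-edge i = consecutive (inject₁ i) (fsuc i) (cong suc (sym (toℕ-inject₁ i)))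

  no-edge-into-origin : ∀ u → ¬ Edge u (v fzero)
  no-edge-into-origin u E with closed u (v fzero) E (inj₂ (fzero , refl))
  ... | i , i' , i'≡1+i , _ , vi'≡v0 with injective vi'≡v0
  ...   | refl = ℕP.0≢1+n i'≡1+i

  no-edge-from-terminal : ∀ w → ¬ Edge (v (fromℕ n)) w
  no-edge-from-terminal w E with closed (v (fromℕ n)) w E (inj₁ (fromℕ n , refl))
  ... | i , i' , i'≡1+i , vi≡vn , _ with injective vi≡vn
  ...   | refl = ℕP.n≮n (suc n)
                   (subst (_< suc n) (trans i'≡1+i (cong suc (toℕ-fromℕ n))) (toℕ<n i'))

  origin : e fzero ≡ - + 1 × suc (proj₁ (v fzero)) ≡ m
  origin with top-row (valid fzero) reaches (proj₂ (posPart-sign≤1 (sign t₀)))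
    where
    t₀ : Fin s
    t₀ = proj₂ (v fzero)
    reaches : m ≤ proj₁ (v fzero) ℕ.+ posPart (- ε t₀)
    reaches = source-height two≤s (proj₂ (prev t₀)) (unmarked fzero) no-edge-into-origin
  ... | b≡1 , top = sign-from-negPart (sign (proj₂ (v fzero))) b≡1 , top

  terminal : e (fromℕ n) ≡ + 1 × suc (proj₁ (v (fromℕ n))) ≡ m
  terminal with top-row (valid (fromℕ n)) reaches (proj₁ (posPart-sign≤1 (sign tₙ)))
    where
    tₙ : Fin s
    tₙ = proj₂ (v (fromℕ n))
    reaches : m ≤ height (v (fromℕ n))
    reaches = sink-height two≤s (unmarked (fromℕ n)) no-edge-from-terminal
  ... | a≡1 , top = sign-from-posPart (sign (proj₂ (v (fromℕ n)))) a≡1 , top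

  height-profile : ∀ i → + height (v i) ≡ + m + S (suc (toℕ i))
  height-profile = <-weakInduction (λ i → + height (v i) ≡ + m + S (suc (toℕ i))) base step
    where
    open ≡-Reasoning
    base : + height (v fzero) ≡ + m + S 1
    l₀ : ℕ
    l₀ = proj₁ (v fzero)
    e₀≡-1 : e fzero ≡ - + 1
    e₀≡-1 = proj₁ origin
    base = begin
      + (l₀ ℕ.+ posPart (e fzero))  ≡⟨ cong (λ x → + (l₀ ℕ.+ posPart x)) e₀≡-1 ⟩
      + (l₀ ℕ.+ 0)                  ≡⟨ cong +_ (ℕP.+-identityʳ l₀) ⟩
      + suc l₀ + - + 1              ≡⟨ cong (λ k → + k + - + 1) (proj₂ origin) ⟩
      + m + - + 1                   ≡⟨ cong (λ x → + m + x) e₀≡-1 ⟨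
      + m + e fzero                 ≡⟨ cong (λ x → + m + x) (ℤP.+-identityˡ (e fzero)) ⟨
      + m + (+ 0 + e fzero)         ≡⟨ cong (λ x → + m + x) (psum-suc e fzero) ⟨
      + m + S 1                     ∎
    step : ∀ i → + height (v (inject₁ i)) ≡ + m + S (suc (toℕ (inject₁ i))) →
                 + height (v (fsuc i)) ≡ + m + S (suc (toℕ (fsuc i)))
    step i IH = begin
      + height (v (fsuc i))                                ≡⟨ edge-height (path-edge i) ⟩
      + height (v (inject₁ i)) + e (fsuc i)                ≡⟨ cong (_+ e (fsuc i)) IH ⟩
      + m + S (suc (toℕ (inject₁ i))) + e (fsuc i)         ≡⟨ ℤP.+-assoc (+ m) (S (suc (toℕ (inject₁ i)))) (e (fsuc i)) ⟩
      + m + (S (suc (toℕ (inject₁ i))) + e (fsuc i))       ≡⟨ cong (λ X → + m + X) (psum-extend e i) ⟨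
      + m + S (suc (toℕ (fsuc i)))                         ∎

  origin-row : l fzero ≡ + m - + 1
  origin-row = offset (trans (ℕP.+-comm (proj₁ (v fzero)) 1) (proj₂ origin))

  coordinates : ∀ i →
    (e i ≡ - + 1 → (l i ≡ l fzero + S (suc (toℕ i)) + + 1) × (l i ≡ + m + S (suc (toℕ i)))) ×
    (e i ≡ + 1 → (l i ≡ l fzero + S (suc (toℕ i))) × (l i ≡ + m - + 1 + S (suc (toℕ i))))
  coordinates i =
    (λ e≡-1 → let row = proj₁ rows e≡-1 in
      trans row (trans (shift-neg (+ m) Sᵢ) (cong (λ x → x + Sᵢ + + 1) (sym origin-row))) , row) ,
    (λ e≡1 → let row = trans (proj₂ rows e≡1) (shift-pos (+ m) Sᵢ) in
      trans row (cong (_+ Sᵢ) (sym origin-row)) , row)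
    where
    Sᵢ : ℤ
    Sᵢ = S (suc (toℕ i))
    rows : (e i ≡ - + 1 → l i ≡ + m + Sᵢ) × (e i ≡ + 1 → l i ≡ + m + Sᵢ - + 1)
    rows = row-from-height (height-profile i)
    shift-neg : ∀ M X → M + X ≡ M - + 1 + X + + 1
    shift-neg = solve-∀
    shift-pos : ∀ M X → M + X - + 1 ≡ M - + 1 + X
    shift-pos = solve-∀

  -- The terminal has height m, so the total sum vanishes.
  total-sum : S (suc n) ≡ + 0
  total-sum = trans (solve-for (+ m) profile) (ℤP.+-inverseʳ (+ m))
    where
    lₙ : ℕ
    lₙ = proj₁ (v (fromℕ n))
    height≡m : height (v (fromℕ n)) ≡ m
    height≡m = trans (cong (λ x → lₙ ℕ.+ posPart x) (proj₁ terminal))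
                     (trans (ℕP.+-comm lₙ 1) (proj₂ terminal))
    profile : + m ≡ + m + S (suc n)
    profile = trans (cong +_ (sym height≡m))
                    (trans (height-profile (fromℕ n)) (cong (λ k → + m + S (suc k)) (toℕ-fromℕ n)))

  -- For 1 ≤ k ≤ n, S_k + m is the height of the tail of the k-th edge, so in [0, m).
  partial-sums : ∀ k → 1 ≤ k → k ≤ n → (- + m ℤ.≤ S k) × (S k ℤ.< + 0)
  partial-sums (suc k) _ k<n =
    subst (λ X → (- + m ℤ.≤ X) × (X ℤ.< + 0)) (sym Sk≡h-m)
          (shifted-bound (edge-tail-height (path-edge i)))
    where
    i : Fin n
    i = fromℕ< k<n
    toℕ-i : toℕ (inject₁ i) ≡ k
    toℕ-i = trans (toℕ-inject₁ i) (toℕ-fromℕ< k<n)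
    Sk≡h-m : S (suc k) ≡ + height (v (inject₁ i)) - + m
    Sk≡h-m = solve-for (+ m) (subst (λ j → + height (v (inject₁ i)) ≡ + m + S (suc j)) toℕ-i
                              (height-profile (inject₁ i)))

lemma4p3 : (m s : ℕ) → 1 ≤ m → (ε : Fin s → ℤ) → IsSignSeq ε →
    (n : ℕ) → (v : Fin (suc n) → ℕ × Fin s) → Γ.IsFreeLinear m s ε n v →
    let e = λ (i : Fin (suc n)) → ε (proj₂ (v i))
        l = λ (i : Fin (suc n)) → + proj₁ (v i)
        S = λ (k : ℕ) → psum e k
    in (∀ (i : Fin (suc n)) →
          (e i ≡ - + 1 → (l i ≡ l fzero + S (suc (toℕ i)) + + 1) × (l i ≡ + m + S (suc (toℕ i)))) ×
          (e i ≡ + 1 → (l i ≡ l fzero + S (suc (toℕ i))) × (l i ≡ + m - + 1 + S (suc (toℕ i))))) ×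
       S (suc n) ≡ + 0 ×
       (∀ (k : ℕ) → 1 ≤ k → k ≤ n → (- + m ℤ.≤ S k) × (S k ℤ.< + 0))
lemma4p3 m s _ ε sign n v free = coordinates , total-sum , partial-sums
  where open FreePath m s ε sign n v free
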